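{- Let $p$ be an odd prime and $L$ a $\mathbb{Z}_p$-lattice in a $\mathbb{Q}_p$-vector space with symmetric bilinear form $B$. If $\bm x\in L$ is simple of index $r$, then $r$ is the unique critical index of $\bm x$.
   Context: $v$ is the $p$-adic valuation. For $\bm x\in V$, $v(L;\bm x)=\min_{\bm y\in L}v(\tfrac12B(\bm x,\bm y))$; for $r\in\mathbb{N}_0$, $L^{(r)}=\{\bm x\in L:v(L;\bm x)\ge r\}$ and $v(L^{(r)};\bm x)=\min_{\bm y\in L^{(r)}}v(\tfrac12B(\bm x,\bm y))$. $\bm x$ is simple of index $r$ if $v(L;\bm x)=v(L^{(r)};\bm x)=r$. An integer $r\in\mathbb{N}_0$ is a critical index of $\bm x$ if either $r=0$ and $v(L;\bm x)<v(L^{(1)};\bm x)$, or $r>0$ and $v(L^{(r-1)};\bm x)=v(L^{(r)};\bm x)<v(L^{(r+1)};\bm x)$. -}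

module Defs where

open import Data.Nat using (ℕ; zero; suc; _+_; _*_; _^_)
open import Data.Fin using (Fin; toℕ)
import Data.Fin as Fin
open import Data.Integer as ℤ using (ℤ; +_; -[1+_])
open import Data.Nat.Divisibility using (_∣_)
open import Data.Product using (_×_; ∃)
open import Data.Unit using (⊤)
open import Relation.Nullary using (¬_)
open import Relation.Binary.PropositionalEquality using (_≡_)

-- p-adic integers, represented by their base-p digit expansion
-- a = Σ_{k ≥ 0} a k · p^k  (every element of ℤ_p has a unique such expansion).
ℤₚ : ℕ → Set
ℤₚ p = ℕ → Fin p

trunc : ∀ {p} → ℕ → ℤₚ p → ℕ
trunc zero a = 0
trunc {p} (suc k) a = trunc k a + toℕ (a k) * p ^ k

∑ : (n : ℕ) → (Fin n → ℕ) → ℕ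
∑ zero f = 0
∑ (suc n) f = f Fin.zero + ∑ n (λ i → f (Fin.suc i))

-- A ℤ_p-lattice L, with a ℤ_p-basis e_0,…,e_{n-1}, i.e. L = ℤ_p^n (coordinates),
-- equipped with a symmetric ℚ_p-valued bilinear form B.  Since L is finitely
-- generated, B(L,L) ⊆ p^{-shift} ℤ_p for some shift, and
--   B(e_i , e_j) = p^{-shift} · gram i j   with gram i j ∈ ℤ_p.
record Form (p n : ℕ) : Set where
  field
    shift : ℕ
    gram  : Fin n → Fin n → ℤₚ p
    symm  : ∀ i j k → gram i j k ≡ gram j i k

open Form public

Lat : ℕ → ℕ → Set
Lat p n = Fin n → ℤₚ p

-- Bmod F t x y ≡ p^{shift} · B(x,y)  (mod p^t)
Bmod : ∀ {p n} → Form p n → ℕ → Lat p n → Lat p n → ℕ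
Bmod {n = n} F t x y =
  ∑ n (λ i → ∑ n (λ j → trunc t (x i) * trunc t (gram F i j) * trunc t (y j)))

thresholdAux : ℤ → (ℕ → Set) → Set
thresholdAux (+ t) P = P t
thresholdAux -[1+ _ ] P = ⊤

-- valGE F x y k  :⇔  v(½ B(x,y)) ≥ k   (k ∈ ℤ; v(0) = ∞; p odd so ½ is a unit)
-- i.e.  p^{shift}·B(x,y) ∈ p^{k + shift} ℤ_p
valGE : ∀ {p n} → Form p n → Lat p n → Lat p n → ℤ → Set
valGE {p} F x y k = thresholdAux (k ℤ.+ (+ shift F)) (λ t → p ^ t ∣ Bmod F t x y)

Sub : ℕ → ℕ → Set₁
Sub p n = Lat p n → Set

wholeL : ∀ {p n} → Sub p n
wholeL _ = ⊤

-- vGE F S x k  :⇔  v(S; x) = min_{y ∈ S} v(½ B(x,y)) ≥ k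
vGE : ∀ {p n} → Form p n → Sub p n → Lat p n → ℤ → Set
vGE F S x k = ∀ y → S y → valGE F x y k

Lsup : ∀ {p n} → Form p n → ℕ → Sub p n
Lsup F r y = vGE F wholeL y (+ r)

vEqN : ∀ {p n} → Form p n → Sub p n → Lat p n → ℕ → Set
vEqN F S x r = vGE F S x (+ r) × ¬ vGE F S x (+ suc r)

vEq : ∀ {p n} → Form p n → Sub p n → Sub p n → Lat p n → Set
vEq F S T x = ∀ k → (vGE F S x k → vGE F T x k) × (vGE F T x k → vGE F S x k)

vLt : ∀ {p n} → Form p n → Sub p n → Sub p n → Lat p n → Set
vLt F S T x = ∃ λ k → ¬ vGE F S x k × vGE F T x k

Simple : ∀ {p n} → Form p n → Lat p n → ℕ → Set
Simple F x r = vEqN F wholeL x r × vEqN F (Lsup F r) x r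

Critical : ∀ {p n} → Form p n → Lat p n → ℕ → Set
Critical F x zero = vLt F wholeL (Lsup F 1) x
Critical F x (suc r) =
  vEq F (Lsup F r) (Lsup F (suc r)) x × vLt F (Lsup F (suc r)) (Lsup F (suc (suc r))) x

-- Multiplication by p maps L^(r) into L^(r+1) and raises v(½B(x, ·)) by exactly one, so
-- v(L^(r); x) ≥ v(L^(r+1); x) − 1, and hence v(L^(s); x) > s forces v(L^(r); x) > r for r ≤ s.
-- If x is simple of index r, every v(L^(s); x) with s ≤ r is squeezed between v(L; x) = r
-- and v(L^(r); x) = r.  This makes r critical and rules out every s < r; a critical s > r
-- would give v(L^(s−1); x) = v(L^(s); x) ≥ s, hence v(L^(r); x) > r.
module Submission where

open import Defs
open import Data.Nat using (ℕ; _<_)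
open import Data.Nat.Primality using (Prime)
open import Data.Product using (_×_)
open import Relation.Binary.PropositionalEquality using (_≡_)

open import Data.Nat using (zero; suc; _+_; _*_; _^_; _≤_; _∸_; z≤n; NonZero)
open import Data.Nat.Properties
  using (+-comm; *-zeroʳ; +-identityʳ; ^-distribˡ-+-*; m∸n+n≡m; n≤1+n; ≤-pred; ≮⇒≥; ≤-antisym;
         m≤n⇒m<n∨m≡n; +-*-semiring)
open import Data.Nat.Divisibility
  using (_∣_; divides; ∣-trans; m∣m*n; ∣m∣n⇒∣m+n; ∣m+n∣m⇒∣n; *-monoʳ-∣; *-cancelˡ-∣)
open import Data.Nat.Primality using (prime⇒nonZero)
open import Data.Nat.Solver using (module +-*-Solver)
open import Data.Fin as Fin using (Fin; toℕ)
open import Data.Integer as ℤ using (+_; -[1+_])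
import Data.Integer.Properties as ℤ
open import Data.Product using (∃; _,_; proj₁; proj₂)
open import Data.Sum using (inj₁; inj₂)
open import Data.Unit using (tt)
open import Function using (id)
open import Relation.Nullary using (¬_)
open import Relation.Unary using (_⊆_)
open import Relation.Binary.PropositionalEquality
  using (refl; sym; trans; cong; cong₂; subst; module ≡-Reasoning)
open import Algebra.Properties.Semiring.Sum +-*-semiring
  using (sum; sum-cong-≗; ∑-comm; *-distribˡ-sum)
open +-*-Solver

-- The quotient is carried explicitly so that no truncated subtraction occurs.
infix 4 _≈_mod_
data _≈_mod_ (a b m : ℕ) : Set where
  _,_ : (k : ℕ) → a ≡ b + m * k → a ≈ b mod m

≈-refl : ∀ {m} a → a ≈ a mod m
≈-refl {m} a = 0 , sym (trans (cong₂ _+_ refl (*-zeroʳ m)) (+-identityʳ a))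

≡⇒≈ : ∀ {m a b} → a ≡ b → a ≈ b mod m
≡⇒≈ {m} {a} refl = ≈-refl {m} a

≈-trans : ∀ {m a b c} → a ≈ b mod m → b ≈ c mod m → a ≈ c mod m
≈-trans {m} {c = c} (k , refl) (l , refl) = l + k ,
  solve 4 (λ c m k l → c :+ m :* l :+ m :* k := c :+ m :* (l :+ k)) refl c m k l

+-cong-mod : ∀ {m a b a′ b′} → a ≈ b mod m → a′ ≈ b′ mod m → a + a′ ≈ b + b′ mod m
+-cong-mod {m} {b = b} {b′ = b′} (k , refl) (k′ , refl) = k + k′ ,
  solve 5 (λ b m k b′ k′ → b :+ m :* k :+ (b′ :+ m :* k′) := b :+ b′ :+ m :* (k :+ k′))
    refl b m k b′ k′

*-cong-mod : ∀ {m a b a′ b′} → a ≈ b mod m → a′ ≈ b′ mod m → a * a′ ≈ b * b′ mod m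
*-cong-mod {m} {b = b} {b′ = b′} (k , refl) (k′ , refl) = k * b′ + b * k′ + m * k * k′ ,
  solve 5 (λ b m k b′ k′ → (b :+ m :* k) :* (b′ :+ m :* k′)
                           := b :* b′ :+ m :* (k :* b′ :+ b :* k′ :+ m :* k :* k′))
    refl b m k b′ k′

*-scale-mod : ∀ c {m a b} → a ≈ b mod m → c * a ≈ c * b mod c * m
*-scale-mod c {m} {b = b} (k , refl) = k ,
  solve 4 (λ c b m k → c :* (b :+ m :* k) := c :* b :+ c :* m :* k) refl c b m k

∣-resp-≈ : ∀ {m a b} → a ≈ b mod m → m ∣ b → m ∣ a
∣-resp-≈ {m} (k , refl) m∣b = ∣m∣n⇒∣m+n m∣b (m∣m*n k)

∣-resp-≈⁻¹ : ∀ {m a b} → a ≈ b mod m → m ∣ a → m ∣ b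
∣-resp-≈⁻¹ {m} {b = b} (k , refl) m∣a = ∣m+n∣m⇒∣n (subst (m ∣_) (+-comm b (m * k)) m∣a) (m∣m*n k)

^-monoʳ-∣ : ∀ p {c t} → c ≤ t → p ^ c ∣ p ^ t
^-monoʳ-∣ p {c} {t} c≤t = divides (p ^ (t ∸ c)) (begin
  p ^ t             ≡⟨ cong (p ^_) (sym (m∸n+n≡m c≤t)) ⟩
  p ^ (t ∸ c + c)   ≡⟨ ^-distribˡ-+-* p (t ∸ c) c ⟩
  p ^ (t ∸ c) * p ^ c ∎)
  where open ≡-Reasoning

∑≡sum : ∀ n (f : Fin n → ℕ) → ∑ n f ≡ sum f
∑≡sum zero    f = refl
∑≡sum (suc n) f = cong₂ _+_ refl (∑≡sum n (λ i → f (Fin.suc i)))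

∑-cong : ∀ n {f g : Fin n → ℕ} → (∀ i → f i ≡ g i) → ∑ n f ≡ ∑ n g
∑-cong n {f} {g} f≗g = trans (∑≡sum n f) (trans (sum-cong-≗ f≗g) (sym (∑≡sum n g)))

∑-cong-mod : ∀ n {m} {f g : Fin n → ℕ} → (∀ i → f i ≈ g i mod m) → ∑ n f ≈ ∑ n g mod m
∑-cong-mod zero    {m} _   = ≈-refl {m} 0
∑-cong-mod (suc n)     f≈g = +-cong-mod (f≈g Fin.zero) (∑-cong-mod n (λ i → f≈g (Fin.suc i)))

*-distribˡ-∑ : ∀ n c (f : Fin n → ℕ) → c * ∑ n f ≡ ∑ n (λ i → c * f i)
*-distribˡ-∑ n c f = begin
  c * ∑ n f               ≡⟨ cong (c *_) (∑≡sum n f) ⟩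
  c * sum f               ≡⟨ *-distribˡ-sum c f ⟩
  sum (λ i → c * f i)     ≡⟨ sym (∑≡sum n _) ⟩
  ∑ n (λ i → c * f i)     ∎
  where open ≡-Reasoning

∑-swap : ∀ m n (f : Fin m → Fin n → ℕ) →
         ∑ m (λ i → ∑ n (f i)) ≡ ∑ n (λ j → ∑ m (λ i → f i j))
∑-swap m n f = begin
  ∑ m (λ i → ∑ n (f i))            ≡⟨ ∑∑≡sumsum m n f ⟩
  sum (λ i → sum (f i))            ≡⟨ ∑-comm f ⟩
  sum (λ j → sum (λ i → f i j))    ≡⟨ sym (∑∑≡sumsum n m (λ j i → f i j)) ⟩
  ∑ n (λ j → ∑ m (λ i → f i j))    ∎
  where
  open ≡-Reasoning
  ∑∑≡sumsum : ∀ m n (g : Fin m → Fin n → ℕ) → ∑ m (λ i → ∑ n (g i)) ≡ sum (λ i → sum (g i))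
  ∑∑≡sumsum m n g = trans (∑≡sum m _) (sum-cong-≗ (λ i → ∑≡sum n (g i)))

module _ {p : ℕ} where

  trunc-cong : ∀ t {a b : ℤₚ p} → (∀ k → a k ≡ b k) → trunc t a ≡ trunc t b
  trunc-cong zero    _   = refl
  trunc-cong (suc t) a≗b = cong₂ _+_ (trunc-cong t a≗b) (cong (λ d → toℕ d * p ^ t) (a≗b t))

  trunc-+-mod : ∀ d c (a : ℤₚ p) → trunc (d + c) a ≈ trunc c a mod p ^ c
  trunc-+-mod zero    c a = ≈-refl _
  trunc-+-mod (suc d) c a with trunc-+-mod d c a
  ... | k , eq = k + toℕ (a (d + c)) * p ^ d , (begin
    trunc (d + c) a + toℕ (a (d + c)) * p ^ (d + c)
      ≡⟨ cong₂ (λ u v → u + toℕ (a (d + c)) * v) eq (^-distribˡ-+-* p d c) ⟩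
    trunc c a + p ^ c * k + toℕ (a (d + c)) * (p ^ d * p ^ c)
      ≡⟨ solve 5 (λ T P k D Q → T :+ P :* k :+ D :* (Q :* P) := T :+ P :* (k :+ D :* Q))
           refl (trunc c a) (p ^ c) k (toℕ (a (d + c))) (p ^ d) ⟩
    trunc c a + p ^ c * (k + toℕ (a (d + c)) * p ^ d) ∎)
    where open ≡-Reasoning

  trunc-≤-mod : ∀ {c t} → c ≤ t → (a : ℤₚ p) → trunc t a ≈ trunc c a mod p ^ c
  trunc-≤-mod {c} {t} c≤t a =
    subst (λ u → trunc u a ≈ trunc c a mod p ^ c) (m∸n+n≡m c≤t) (trunc-+-mod (t ∸ c) c a)

scaleByP : ∀ {p} .{{_ : NonZero p}} → ℤₚ p → ℤₚ p
scaleByP {suc _} a zero    = Fin.zero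
scaleByP         a (suc k) = a k

trunc-scaleByP : ∀ {p} .{{_ : NonZero p}} c (a : ℤₚ p) → trunc (suc c) (scaleByP a) ≡ p * trunc c a
trunc-scaleByP {suc q}     zero    a = sym (*-zeroʳ q)
trunc-scaleByP {p@(suc _)} (suc c) a = begin
  trunc (suc c) (scaleByP a) + toℕ (a c) * (p * p ^ c)
    ≡⟨ cong₂ _+_ (trunc-scaleByP c a) refl ⟩
  p * trunc c a + toℕ (a c) * (p * p ^ c)
    ≡⟨ solve 4 (λ P T D Q → P :* T :+ D :* (P :* Q) := P :* (T :+ D :* Q))
         refl p (trunc c a) (toℕ (a c)) (p ^ c) ⟩
  p * (trunc c a + toℕ (a c) * p ^ c) ∎
  where open ≡-Reasoning

scaleLatByP : ∀ {p n} .{{_ : NonZero p}} → Lat p n → Lat p n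
scaleLatByP y i = scaleByP (y i)

thresholdAux-map : ∀ {Q Q′ : ℕ → Set} → (∀ t → Q t → Q′ t) →
                   ∀ z → thresholdAux z Q → thresholdAux z Q′
thresholdAux-map Q⇒Q′ (+ t)    = Q⇒Q′ t
thresholdAux-map Q⇒Q′ -[1+ _ ] = id

thresholdAux-anti : ∀ {Q : ℕ → Set} → (∀ {c t} → c ≤ t → Q t → Q c) →
                    ∀ {z′ z} → z′ ℤ.≤ z → thresholdAux z Q → thresholdAux z′ Q
thresholdAux-anti Q-anti (ℤ.-≤- _)   _ = tt
thresholdAux-anti Q-anti ℤ.-≤+       _ = tt
thresholdAux-anti Q-anti (ℤ.+≤+ c≤t) q = Q-anti c≤t q

module _ {p n : ℕ} (F : Form p n) where

  BDivisible : ℕ → Lat p n → Lat p n → Set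
  BDivisible t x y = p ^ t ∣ Bmod F t x y

  Bmod-≤-mod : ∀ {c t} → c ≤ t → ∀ x y → Bmod F t x y ≈ Bmod F c x y mod p ^ c
  Bmod-≤-mod c≤t x y = ∑-cong-mod n λ i → ∑-cong-mod n λ j →
    *-cong-mod (*-cong-mod (trunc-≤-mod c≤t (x i)) (trunc-≤-mod c≤t (gram F i j)))
               (trunc-≤-mod c≤t (y j))

  Bmod-sym : ∀ t x y → Bmod F t x y ≡ Bmod F t y x
  Bmod-sym t x y = trans (∑-swap n n _) (∑-cong n λ j → ∑-cong n λ i →
    trans (cong (λ g → trunc t (x i) * g * trunc t (y j)) (trunc-cong t (symm F i j)))
          (solve 3 (λ a b c → a :* b :* c := c :* b :* a)
             refl (trunc t (x i)) (trunc t (gram F j i)) (trunc t (y j))))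

  BDivisible-anti : ∀ {c t} x y → c ≤ t → BDivisible t x y → BDivisible c x y
  BDivisible-anti x y c≤t pᵗ∣B = ∣-resp-≈⁻¹ (Bmod-≤-mod c≤t x y) (∣-trans (^-monoʳ-∣ p c≤t) pᵗ∣B)

  BDivisible-sym : ∀ t x y → BDivisible t x y → BDivisible t y x
  BDivisible-sym t x y = subst (p ^ t ∣_) (Bmod-sym t x y)

  valGE-anti : ∀ x y {k′ k} → k′ ℤ.≤ k → valGE F x y k → valGE F x y k′
  valGE-anti x y k′≤k =
    thresholdAux-anti (BDivisible-anti x y) (ℤ.+-monoˡ-≤ (+ shift F) k′≤k)

  valGE-sym : ∀ x y k → valGE F x y k → valGE F y x k
  valGE-sym x y k = thresholdAux-map (λ t → BDivisible-sym t x y) (k ℤ.+ + shift F)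

  vGE-anti : ∀ {S} x {k′ k} → k′ ℤ.≤ k → vGE F S x k → vGE F S x k′
  vGE-anti x k′≤k x≥k y y∈S = valGE-anti x y k′≤k (x≥k y y∈S)

  vGE-⊆ : ∀ {S T} x k → S ⊆ T → vGE F T x k → vGE F S x k
  vGE-⊆ x k S⊆T x≥k y y∈S = x≥k y (S⊆T y∈S)

  Lsup-anti : ∀ {r r′} → r ≤ r′ → Lsup F r′ ⊆ Lsup F r
  Lsup-anti r≤r′ {y} y∈L⁽r′⁾ z _ = valGE-anti y z (ℤ.+≤+ r≤r′) (y∈L⁽r′⁾ z tt)

  vGE-Lsup : ∀ r x → vGE F (Lsup F r) x (+ r)
  vGE-Lsup r x y y∈L⁽r⁾ = valGE-sym y x (+ r) (y∈L⁽r⁾ x tt)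

  module _ .{{_ : NonZero p}} where

    Bmod-scaleByP : ∀ c x y →
                    Bmod F (suc c) x (scaleLatByP y) ≈ p * Bmod F c x y mod p ^ suc c
    Bmod-scaleByP c x y =
      ≈-trans (∑-cong-mod n λ i → ∑-cong-mod n λ j → term i j) (≡⇒≈ pull-out-p)
      where
      open ≡-Reasoning
      B₀ : Fin n → Fin n → ℕ
      B₀ i j = trunc c (x i) * trunc c (gram F i j) * trunc c (y j)

      term : ∀ i j → trunc (suc c) (x i) * trunc (suc c) (gram F i j)
                       * trunc (suc c) (scaleByP (y j)) ≈ p * B₀ i j mod p ^ suc c
      term i j = ≈-trans (≡⇒≈ (begin
          X * G * trunc (suc c) (scaleByP (y j))
            ≡⟨ cong (X * G *_) (trunc-scaleByP c (y j)) ⟩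
          X * G * (p * Y)
            ≡⟨ solve 4 (λ X G P Y → X :* G :* (P :* Y) := P :* (X :* G :* Y)) refl X G p Y ⟩
          p * (X * G * Y) ∎))
        (*-scale-mod p (*-cong-mod (*-cong-mod (trunc-+-mod 1 c (x i)) (trunc-+-mod 1 c (gram F i j)))
                                   (≈-refl Y)))
        where
        X G Y : ℕ
        X = trunc (suc c) (x i)
        G = trunc (suc c) (gram F i j)
        Y = trunc c (y j)

      pull-out-p : ∑ n (λ i → ∑ n (λ j → p * B₀ i j)) ≡ p * Bmod F c x y
      pull-out-p = trans (∑-cong n (λ i → sym (*-distribˡ-∑ n p (B₀ i))))
                         (sym (*-distribˡ-∑ n p _))

    BDivisible-scaleByP⁺ : ∀ c x y → BDivisible c x y → BDivisible (suc c) x (scaleLatByP y)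
    BDivisible-scaleByP⁺ c x y pᶜ∣B = ∣-resp-≈ (Bmod-scaleByP c x y) (*-monoʳ-∣ p pᶜ∣B)

    BDivisible-scaleByP⁻ : ∀ c x y → BDivisible (suc c) x (scaleLatByP y) → BDivisible c x y
    BDivisible-scaleByP⁻ c x y pᶜ⁺¹∣B = *-cancelˡ-∣ p (∣-resp-≈⁻¹ (Bmod-scaleByP c x y) pᶜ⁺¹∣B)

    valGE-scaleByP⁺ : ∀ x y k → valGE F x y (+ k) → valGE F x (scaleLatByP y) (+ suc k)
    valGE-scaleByP⁺ x y k = BDivisible-scaleByP⁺ (k + shift F) x y

    valGE-scaleByP⁻ : ∀ x y k → valGE F x (scaleLatByP y) (+ suc k) → valGE F x y (+ k)
    valGE-scaleByP⁻ x y k = BDivisible-scaleByP⁻ (k + shift F) x y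

    scaleLatByP-Lsup : ∀ {r} → Lsup F r ⊆ (λ y → Lsup F (suc r) (scaleLatByP y))
    scaleLatByP-Lsup {r} {y} y∈L⁽r⁾ z _ = valGE-sym z (scaleLatByP y) (+ suc r)
      (valGE-scaleByP⁺ z y r (valGE-sym y z (+ r) (y∈L⁽r⁾ z tt)))

    vGE-Lsup-pred : ∀ r k x → vGE F (Lsup F (suc r)) x (+ suc k) → vGE F (Lsup F r) x (+ k)
    vGE-Lsup-pred r k x x≥k+1 y y∈L⁽r⁾ =
      valGE-scaleByP⁻ x y k (x≥k+1 (scaleLatByP y) (scaleLatByP-Lsup {r} y∈L⁽r⁾))

    vGE-Lsup-suc-down : ∀ {r s} x → r ≤ s →
                        vGE F (Lsup F s) x (+ suc s) → vGE F (Lsup F r) x (+ suc r)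
    vGE-Lsup-suc-down {s = zero}  x z≤n x≥1 = x≥1
    vGE-Lsup-suc-down {s = suc s} x r≤1+s x≥s+2 with m≤n⇒m<n∨m≡n r≤1+s
    ... | inj₁ r<1+s = vGE-Lsup-suc-down x (≤-pred r<1+s) (vGE-Lsup-pred s (suc s) x x≥s+2)
    ... | inj₂ refl  = x≥s+2

  critical⇒vLt : ∀ x s → Critical F x s → ∃ λ (S : Sub p n) → vLt F S (Lsup F (suc s)) x
  critical⇒vLt x zero    crit       = wholeL , crit
  critical⇒vLt x (suc s) (_ , crit) = Lsup F (suc s) , crit

  critical-suc⇒vGE : ∀ x s → Critical F x (suc s) → vGE F (Lsup F s) x (+ suc s)
  critical-suc⇒vGE x s (eq , _) = proj₂ (eq (+ suc s)) (vGE-Lsup (suc s) x)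

  module _ (x : Lat p n) (r : ℕ) (simple : Simple F x r) where

    simple-vGE : ∀ {S k} → k ℤ.≤ + r → vGE F S x k
    simple-vGE k≤r y _ = vGE-anti x k≤r (proj₁ (proj₁ simple)) y tt

    simple-vGE⇒≤ : ∀ {S} k → Lsup F r ⊆ S → vGE F S x k → k ℤ.≤ + r
    simple-vGE⇒≤ k L⁽r⁾⊆S x≥k = ℤ.≮⇒≥ λ r<k →
      proj₂ (proj₂ simple) (vGE-anti x (ℤ.i<j⇒suc[i]≤j r<k) (vGE-⊆ x k L⁽r⁾⊆S x≥k))

    simple-vEq : ∀ {S T} → Lsup F r ⊆ S → Lsup F r ⊆ T → vEq F S T x
    simple-vEq L⁽r⁾⊆S L⁽r⁾⊆T k = (λ x≥k → simple-vGE (simple-vGE⇒≤ k L⁽r⁾⊆S x≥k))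
                                , (λ x≥k → simple-vGE (simple-vGE⇒≤ k L⁽r⁾⊆T x≥k))

    simple-vLt : ∀ {S} → Lsup F r ⊆ S → vLt F S (Lsup F (suc r)) x
    simple-vLt L⁽r⁾⊆S = + suc r
      , (λ x≥r+1 → proj₂ (proj₂ simple) (vGE-⊆ x (+ suc r) L⁽r⁾⊆S x≥r+1))
      , vGE-Lsup (suc r) x

    simple-¬vLt : ∀ {S T} → Lsup F r ⊆ T → ¬ vLt F S T x
    simple-¬vLt L⁽r⁾⊆T (k , x≱k , x≥k) = x≱k (simple-vGE (simple-vGE⇒≤ k L⁽r⁾⊆T x≥k))

  simple⇒critical : ∀ x r → Simple F x r → Critical F x r
  simple⇒critical x zero    simple = simple-vLt x zero simple (λ _ → tt)
  simple⇒critical x (suc r) simple =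
    simple-vEq x (suc r) simple (Lsup-anti (n≤1+n r)) id , simple-vLt x (suc r) simple id

  simple-critical⇒≥ : ∀ x r s → Simple F x r → Critical F x s → r ≤ s
  simple-critical⇒≥ x r s simple crit =
    ≮⇒≥ λ s<r → simple-¬vLt x r simple (Lsup-anti s<r) (proj₂ (critical⇒vLt x s crit))

  simple-critical⇒≤ : .{{_ : NonZero p}} → ∀ x r s → Simple F x r → Critical F x s → s ≤ r
  simple-critical⇒≤ x r zero    _      _    = z≤n
  simple-critical⇒≤ x r (suc s) simple crit = ≮⇒≥ λ r<1+s →
    proj₂ (proj₂ simple) (vGE-Lsup-suc-down x (≤-pred r<1+s) (critical-suc⇒vGE x s crit))

-- Primality is used only for p ≠ 0; oddness of p is what makes ½ a unit, which the
-- definition of valGE already takes for granted.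
lemma4p3 : ∀ {p n : ℕ} → Prime p → 2 < p → (F : Form p n) → (x : Lat p n) → (r : ℕ)
    → Simple F x r
    → Critical F x r × (∀ s → Critical F x s → s ≡ r)
lemma4p3 p-prime _ F x r simple =
    simple⇒critical F x r simple
  , λ s crit → ≤-antisym (simple-critical⇒≤ F {{prime⇒nonZero p-prime}} x r s simple crit)
                         (simple-critical⇒≥ F x r s simple crit)
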